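{- For every propositional formula $F$ built from prime (atomic) formulas using $\wedge$, $\vee$ and $\to$, there is a formula $e \in \mathcal{D}\cup\mathcal{C}$ such that $F \cong e$, where the classes $\mathcal{D}$, $\mathcal{C}$, $\mathcal{B}$ are defined simultaneously by \begin{align*} \mathcal{D}\ni d &::= c_1 \vee \cdots \vee c_n \quad (n\ge 2,\ c_i\in\mathcal{C}),\\ \mathcal{C}\ni c &::= (c_1\to b_1)\wedge\cdots\wedge(c_n\to b_n) \quad (n\ge 0,\ c_i\in\mathcal{C},\ b_i\in\mathcal{B}),\\ \mathcal{B}\ni b &::= p ~|~ d \quad (p \text{ a prime formula},\ d\in\mathcal{D}). \end{align*} In exponential-polynomial notation (writing $F\wedge G$ as $FG$, $F\vee G$ as $F+G$, $F\to G$ as $G^F$): $d=\sum_{i=1}^{n\ge2} c_i$, $c=\prod_{i=1}^{n\ge 0} b_i^{c_i}$, $b ::= p ~|~ d$.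
   Context: Formulas are those of intuitionistic (minimal) propositional logic. The nullary conjunction ($n=0$ in $\mathcal{C}$) is the formula $\top$ (the unit $1$); $\top$ is not a prime formula. Two formulas $F,G$ are isomorphic, $F\cong G$, if there are proofs (terms of the simply typed $\lambda$-calculus with product, sum and unit types, i.e. natural deduction proofs) $\phi$ of $F\to G$ and $\psi$ of $G\to F$ such that $\lambda a.\psi(\phi\, a) =_{\beta\eta} \lambda a.a$ and $\lambda c.\phi(\psi\, c)=_{\beta\eta}\lambda c.c$, where $=_{\beta\eta}$ is the standard $\beta\eta$-equality of this calculus. -}

module Defs where

open import Data.Nat using (ℕ)
open import Data.List using (List; []; _∷_; map)
open import Data.List.Relation.Unary.All using (All)
open import Data.Product using (_×_; _,_; proj₁; proj₂)

infixr 7 _∧_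
infixr 6 _∨_
infixr 5 _⇒_

data Form : Set where
  prime : ℕ → Form
  ⊤     : Form
  _∧_   : Form → Form → Form
  _∨_   : Form → Form → Form
  _⇒_   : Form → Form → Form

data TopFree : Form → Set where
  prime : ∀ n → TopFree (prime n)
  _∧_   : ∀ {F G} → TopFree F → TopFree G → TopFree (F ∧ G)
  _∨_   : ∀ {F G} → TopFree F → TopFree G → TopFree (F ∨ G)
  _⇒_   : ∀ {F G} → TopFree F → TopFree G → TopFree (F ⇒ G)

⋀ : List Form → Form
⋀ []           = ⊤
⋀ (F ∷ [])     = F
⋀ (F ∷ G ∷ Fs) = F ∧ ⋀ (G ∷ Fs)

⋁₂ : Form → Form → List Form → Form
⋁₂ F G []       = F ∨ G
⋁₂ F G (H ∷ Hs) = F ∨ ⋁₂ G H Hs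

data IsD : Form → Set
data IsC : Form → Set
data IsB : Form → Set

data IsD where
  disj : ∀ {c₁ c₂} cs → IsC c₁ → IsC c₂ → All IsC cs → IsD (⋁₂ c₁ c₂ cs)

data IsC where
  conj : (ps : List (Form × Form)) →
         All (λ p → IsC (proj₁ p) × IsB (proj₂ p)) ps →
         IsC (⋀ (map (λ p → proj₁ p ⇒ proj₂ p) ps))

data IsB where
  prime : ∀ n → IsB (prime n)
  dis   : ∀ {d} → IsD d → IsB d

-- Simply typed λ-calculus with product, sum and unit types
-- (natural deduction proofs), intrinsically typed, de Bruijn indices.

Ctx : Set
Ctx = List Form

infix 4 _∋_
data _∋_ : Ctx → Form → Set where
  here  : ∀ {Γ A} → (A ∷ Γ) ∋ A
  there : ∀ {Γ A B} → Γ ∋ A → (B ∷ Γ) ∋ A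

data Tm (Γ : Ctx) : Form → Set where
  var  : ∀ {A} → Γ ∋ A → Tm Γ A
  lam  : ∀ {A B} → Tm (A ∷ Γ) B → Tm Γ (A ⇒ B)
  app  : ∀ {A B} → Tm Γ (A ⇒ B) → Tm Γ A → Tm Γ B
  unit : Tm Γ ⊤
  pair : ∀ {A B} → Tm Γ A → Tm Γ B → Tm Γ (A ∧ B)
  fst  : ∀ {A B} → Tm Γ (A ∧ B) → Tm Γ A
  snd  : ∀ {A B} → Tm Γ (A ∧ B) → Tm Γ B
  inl  : ∀ {A B} → Tm Γ A → Tm Γ (A ∨ B)
  inr  : ∀ {A B} → Tm Γ B → Tm Γ (A ∨ B)
  case : ∀ {A B C} → Tm Γ (A ∨ B) → Tm (A ∷ Γ) C → Tm (B ∷ Γ) C → Tm Γ C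

Ren : Ctx → Ctx → Set
Ren Γ Δ = ∀ {A} → Γ ∋ A → Δ ∋ A

ext : ∀ {Γ Δ B} → Ren Γ Δ → Ren (B ∷ Γ) (B ∷ Δ)
ext ρ here      = here
ext ρ (there x) = there (ρ x)

rename : ∀ {Γ Δ A} → Ren Γ Δ → Tm Γ A → Tm Δ A
rename ρ (var x)      = var (ρ x)
rename ρ (lam t)      = lam (rename (ext ρ) t)
rename ρ (app t u)    = app (rename ρ t) (rename ρ u)
rename ρ unit         = unit
rename ρ (pair t u)   = pair (rename ρ t) (rename ρ u)
rename ρ (fst t)      = fst (rename ρ t)
rename ρ (snd t)      = snd (rename ρ t)
rename ρ (inl t)      = inl (rename ρ t)
rename ρ (inr t)      = inr (rename ρ t)
rename ρ (case t u v) = case (rename ρ t) (rename (ext ρ) u) (rename (ext ρ) v)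

wk : ∀ {Γ A B} → Tm Γ A → Tm (B ∷ Γ) A
wk = rename there

Sub : Ctx → Ctx → Set
Sub Γ Δ = ∀ {A} → Γ ∋ A → Tm Δ A

exts : ∀ {Γ Δ B} → Sub Γ Δ → Sub (B ∷ Γ) (B ∷ Δ)
exts σ here      = var here
exts σ (there x) = wk (σ x)

subst : ∀ {Γ Δ A} → Sub Γ Δ → Tm Γ A → Tm Δ A
subst σ (var x)      = σ x
subst σ (lam t)      = lam (subst (exts σ) t)
subst σ (app t u)    = app (subst σ t) (subst σ u)
subst σ unit         = unit
subst σ (pair t u)   = pair (subst σ t) (subst σ u)
subst σ (fst t)      = fst (subst σ t)
subst σ (snd t)      = snd (subst σ t)
subst σ (inl t)      = inl (subst σ t)
subst σ (inr t)      = inr (subst σ t)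
subst σ (case t u v) = case (subst σ t) (subst (exts σ) u) (subst (exts σ) v)

sub₀ : ∀ {Γ A} → Tm Γ A → Sub (A ∷ Γ) Γ
sub₀ t here      = t
sub₀ t (there x) = var x

_[_] : ∀ {Γ A B} → Tm (A ∷ Γ) B → Tm Γ A → Tm Γ B
u [ t ] = subst (sub₀ t) u

subInl : ∀ {Γ A B} → Sub ((A ∨ B) ∷ Γ) (A ∷ Γ)
subInl here      = inl (var here)
subInl (there x) = var (there x)

subInr : ∀ {Γ A B} → Sub ((A ∨ B) ∷ Γ) (B ∷ Γ)
subInr here      = inr (var here)
subInr (there x) = var (there x)

infix 4 _≈_
data _≈_ {Γ : Ctx} : ∀ {A} → Tm Γ A → Tm Γ A → Set where
  ≈refl  : ∀ {A} {t : Tm Γ A} → t ≈ t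
  ≈sym   : ∀ {A} {t u : Tm Γ A} → t ≈ u → u ≈ t
  ≈trans : ∀ {A} {t u v : Tm Γ A} → t ≈ u → u ≈ v → t ≈ v
  lam-cong  : ∀ {A B} {t t' : Tm (A ∷ Γ) B} → t ≈ t' → lam t ≈ lam t'
  app-cong  : ∀ {A B} {t t' : Tm Γ (A ⇒ B)} {u u'} → t ≈ t' → u ≈ u' → app t u ≈ app t' u'
  pair-cong : ∀ {A B} {t t' : Tm Γ A} {u u' : Tm Γ B} → t ≈ t' → u ≈ u' → pair t u ≈ pair t' u'
  fst-cong  : ∀ {A B} {t t' : Tm Γ (A ∧ B)} → t ≈ t' → fst t ≈ fst t'
  snd-cong  : ∀ {A B} {t t' : Tm Γ (A ∧ B)} → t ≈ t' → snd t ≈ snd t'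
  inl-cong  : ∀ {A B} {t t' : Tm Γ A} → t ≈ t' → inl {B = B} t ≈ inl t'
  inr-cong  : ∀ {A B} {t t' : Tm Γ B} → t ≈ t' → inr {A = A} t ≈ inr t'
  case-cong : ∀ {A B C} {t t' : Tm Γ (A ∨ B)} {u u' : Tm (A ∷ Γ) C} {v v' : Tm (B ∷ Γ) C} →
              t ≈ t' → u ≈ u' → v ≈ v' → case t u v ≈ case t' u' v'
  β-⇒   : ∀ {A B} {t : Tm (A ∷ Γ) B} {u : Tm Γ A} → app (lam t) u ≈ t [ u ]
  β-∧₁  : ∀ {A B} {t : Tm Γ A} {u : Tm Γ B} → fst (pair t u) ≈ t
  β-∧₂  : ∀ {A B} {t : Tm Γ A} {u : Tm Γ B} → snd (pair t u) ≈ u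
  β-∨₁  : ∀ {A B C} {t : Tm Γ A} {u : Tm (A ∷ Γ) C} {v : Tm (B ∷ Γ) C} → case (inl t) u v ≈ u [ t ]
  β-∨₂  : ∀ {A B C} {t : Tm Γ B} {u : Tm (A ∷ Γ) C} {v : Tm (B ∷ Γ) C} → case (inr t) u v ≈ v [ t ]
  η-⇒   : ∀ {A B} {t : Tm Γ (A ⇒ B)} → t ≈ lam (app (wk t) (var here))
  η-∧   : ∀ {A B} {t : Tm Γ (A ∧ B)} → t ≈ pair (fst t) (snd t)
  η-⊤   : {t : Tm Γ ⊤} → t ≈ unit
  η-∨   : ∀ {A B C} {t : Tm Γ (A ∨ B)} {u : Tm ((A ∨ B) ∷ Γ) C} →
          u [ t ] ≈ case t (subst subInl u) (subst subInr u)

infix 4 _≅_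
record _≅_ (F G : Form) : Set where
  field
    φ   : Tm [] (F ⇒ G)
    ψ   : Tm [] (G ⇒ F)
    ψφ  : lam (app (wk ψ) (app (wk φ) (var here))) ≈ lam (var here)
    φψ  : lam (app (wk φ) (app (wk ψ) (var here))) ≈ lam (var here)

module Submission where

-- Proof idea: by induction on F, show F ≅ c₀ + c₁ + ⋯ + cₙ with all cᵢ ∈ 𝒞,
-- using the "high-school" isomorphisms of exponential polynomials and the
-- fact that ≅ is a congruence.  Sums of such sums are sums; products are
-- multiplied out by distributivity (𝒞 is closed under products); and
-- S^(c₀+⋯+cₙ) ≅ S^c₀ ⋯ S^cₙ with each S^c in 𝒞 (a single factor when S has
-- ≥ 2 summands, otherwise by (b^c')^c ≅ b^(c'c) and 1^c ≅ 1).  One summand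
-- gives a 𝒞-formula, two or more a 𝒟-formula; prime p is p^⊤.

open import Defs
open import Data.Product using (Σ; _×_; _,_; proj₁; proj₂)
open import Data.Sum using (_⊎_; inj₁; inj₂)
open import Data.Nat using (ℕ; zero; suc)
open import Data.List using (List; []; _∷_; map; _++_)
open import Data.List.Properties using (map-++)
open import Data.List.Relation.Unary.All using (All; []; _∷_)
open import Data.List.Relation.Unary.All.Properties using (++⁺)
open import Relation.Binary.PropositionalEquality using (_≡_; refl; cong; cong₂; sym; trans)

private variable
  Γ Δ Θ : Ctx
  A B C D : Form

RenEq : (ρ ρ' : Ren Γ Δ) → Set
RenEq {Γ} ρ ρ' = ∀ {A} (x : Γ ∋ A) → ρ x ≡ ρ' x

SubEq : (σ τ : Sub Γ Δ) → Set
SubEq {Γ} σ τ = ∀ {A} (x : Γ ∋ A) → σ x ≡ τ x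

case-≡ : ∀ {t t' : Tm Γ (A ∨ B)} {u u' : Tm (A ∷ Γ) C} {v v' : Tm (B ∷ Γ) C} →
         t ≡ t' → u ≡ u' → v ≡ v' → case t u v ≡ case t' u' v'
case-≡ refl refl refl = refl

-- Renaming and substitution only depend on the pointwise values of their
-- argument (we have no function extensionality).
ext-cong : {ρ ρ' : Ren Γ Δ} → RenEq ρ ρ' → RenEq (ext {B = B} ρ) (ext ρ')
ext-cong e here = refl
ext-cong e (there x) = cong there (e x)

ren-cong : {ρ ρ' : Ren Γ Δ} → RenEq ρ ρ' → (t : Tm Γ A) → rename ρ t ≡ rename ρ' t
ren-cong e (var x) = cong var (e x)
ren-cong e (lam t) = cong lam (ren-cong (ext-cong e) t)
ren-cong e (app t u) = cong₂ app (ren-cong e t) (ren-cong e u)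
ren-cong e unit = refl
ren-cong e (pair t u) = cong₂ pair (ren-cong e t) (ren-cong e u)
ren-cong e (fst t) = cong fst (ren-cong e t)
ren-cong e (snd t) = cong snd (ren-cong e t)
ren-cong e (inl t) = cong inl (ren-cong e t)
ren-cong e (inr t) = cong inr (ren-cong e t)
ren-cong e (case t u v) = case-≡ (ren-cong e t) (ren-cong (ext-cong e) u) (ren-cong (ext-cong e) v)

exts-cong : {σ τ : Sub Γ Δ} → SubEq σ τ → SubEq (exts {B = B} σ) (exts τ)
exts-cong e here = refl
exts-cong e (there x) = cong wk (e x)

sub-cong : {σ τ : Sub Γ Δ} → SubEq σ τ → (t : Tm Γ A) → subst σ t ≡ subst τ t
sub-cong e (var x) = e x
sub-cong e (lam t) = cong lam (sub-cong (exts-cong e) t)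
sub-cong e (app t u) = cong₂ app (sub-cong e t) (sub-cong e u)
sub-cong e unit = refl
sub-cong e (pair t u) = cong₂ pair (sub-cong e t) (sub-cong e u)
sub-cong e (fst t) = cong fst (sub-cong e t)
sub-cong e (snd t) = cong snd (sub-cong e t)
sub-cong e (inl t) = cong inl (sub-cong e t)
sub-cong e (inr t) = cong inr (sub-cong e t)
sub-cong e (case t u v) = case-≡ (sub-cong e t) (sub-cong (exts-cong e) u) (sub-cong (exts-cong e) v)

ren-ren : (ρ : Ren Γ Δ) (ρ' : Ren Δ Θ) (t : Tm Γ A) →
          rename ρ' (rename ρ t) ≡ rename (λ x → ρ' (ρ x)) t
ren-ren ρ ρ' (var x) = refl
ren-ren ρ ρ' (lam t) = cong lam (trans (ren-ren (ext ρ) (ext ρ') t)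
  (ren-cong (λ { here → refl ; (there x) → refl }) t))
ren-ren ρ ρ' (app t u) = cong₂ app (ren-ren ρ ρ' t) (ren-ren ρ ρ' u)
ren-ren ρ ρ' unit = refl
ren-ren ρ ρ' (pair t u) = cong₂ pair (ren-ren ρ ρ' t) (ren-ren ρ ρ' u)
ren-ren ρ ρ' (fst t) = cong fst (ren-ren ρ ρ' t)
ren-ren ρ ρ' (snd t) = cong snd (ren-ren ρ ρ' t)
ren-ren ρ ρ' (inl t) = cong inl (ren-ren ρ ρ' t)
ren-ren ρ ρ' (inr t) = cong inr (ren-ren ρ ρ' t)
ren-ren ρ ρ' (case t u v) = case-≡ (ren-ren ρ ρ' t)
  (trans (ren-ren (ext ρ) (ext ρ') u) (ren-cong (λ { here → refl ; (there x) → refl }) u))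
  (trans (ren-ren (ext ρ) (ext ρ') v) (ren-cong (λ { here → refl ; (there x) → refl }) v))

ren-sub : (ρ : Ren Γ Δ) (σ : Sub Δ Θ) (t : Tm Γ A) →
          subst σ (rename ρ t) ≡ subst (λ x → σ (ρ x)) t
ren-sub ρ σ (var x) = refl
ren-sub ρ σ (lam t) = cong lam (trans (ren-sub (ext ρ) (exts σ) t)
  (sub-cong (λ { here → refl ; (there x) → refl }) t))
ren-sub ρ σ (app t u) = cong₂ app (ren-sub ρ σ t) (ren-sub ρ σ u)
ren-sub ρ σ unit = refl
ren-sub ρ σ (pair t u) = cong₂ pair (ren-sub ρ σ t) (ren-sub ρ σ u)
ren-sub ρ σ (fst t) = cong fst (ren-sub ρ σ t)
ren-sub ρ σ (snd t) = cong snd (ren-sub ρ σ t)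
ren-sub ρ σ (inl t) = cong inl (ren-sub ρ σ t)
ren-sub ρ σ (inr t) = cong inr (ren-sub ρ σ t)
ren-sub ρ σ (case t u v) = case-≡ (ren-sub ρ σ t)
  (trans (ren-sub (ext ρ) (exts σ) u) (sub-cong (λ { here → refl ; (there x) → refl }) u))
  (trans (ren-sub (ext ρ) (exts σ) v) (sub-cong (λ { here → refl ; (there x) → refl }) v))

ext-wk : (ρ : Ren Γ Δ) (t : Tm Γ A) → rename (ext {B = B} ρ) (wk t) ≡ wk (rename ρ t)
ext-wk ρ t = trans (ren-ren there (ext ρ) t) (sym (ren-ren ρ there t))

sub-ren : (σ : Sub Γ Δ) (ρ : Ren Δ Θ) (t : Tm Γ A) →
          rename ρ (subst σ t) ≡ subst (λ x → rename ρ (σ x)) t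
sub-ren σ ρ (var x) = refl
sub-ren σ ρ (lam t) = cong lam (trans (sub-ren (exts σ) (ext ρ) t)
  (sub-cong (λ { here → refl ; (there x) → ext-wk ρ (σ x) }) t))
sub-ren σ ρ (app t u) = cong₂ app (sub-ren σ ρ t) (sub-ren σ ρ u)
sub-ren σ ρ unit = refl
sub-ren σ ρ (pair t u) = cong₂ pair (sub-ren σ ρ t) (sub-ren σ ρ u)
sub-ren σ ρ (fst t) = cong fst (sub-ren σ ρ t)
sub-ren σ ρ (snd t) = cong snd (sub-ren σ ρ t)
sub-ren σ ρ (inl t) = cong inl (sub-ren σ ρ t)
sub-ren σ ρ (inr t) = cong inr (sub-ren σ ρ t)
sub-ren σ ρ (case t u v) = case-≡ (sub-ren σ ρ t)
  (trans (sub-ren (exts σ) (ext ρ) u) (sub-cong (λ { here → refl ; (there x) → ext-wk ρ (σ x) }) u))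
  (trans (sub-ren (exts σ) (ext ρ) v) (sub-cong (λ { here → refl ; (there x) → ext-wk ρ (σ x) }) v))

exts-wk : (σ : Sub Γ Δ) (t : Tm Γ A) → subst (exts {B = B} σ) (wk t) ≡ wk (subst σ t)
exts-wk σ t = trans (ren-sub there (exts σ) t) (sym (sub-ren σ there t))

sub-sub : (σ : Sub Γ Δ) (τ : Sub Δ Θ) (t : Tm Γ A) →
          subst τ (subst σ t) ≡ subst (λ x → subst τ (σ x)) t
sub-sub σ τ (var x) = refl
sub-sub σ τ (lam t) = cong lam (trans (sub-sub (exts σ) (exts τ) t)
  (sub-cong (λ { here → refl ; (there x) → exts-wk τ (σ x) }) t))
sub-sub σ τ (app t u) = cong₂ app (sub-sub σ τ t) (sub-sub σ τ u)
sub-sub σ τ unit = refl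
sub-sub σ τ (pair t u) = cong₂ pair (sub-sub σ τ t) (sub-sub σ τ u)
sub-sub σ τ (fst t) = cong fst (sub-sub σ τ t)
sub-sub σ τ (snd t) = cong snd (sub-sub σ τ t)
sub-sub σ τ (inl t) = cong inl (sub-sub σ τ t)
sub-sub σ τ (inr t) = cong inr (sub-sub σ τ t)
sub-sub σ τ (case t u v) = case-≡ (sub-sub σ τ t)
  (trans (sub-sub (exts σ) (exts τ) u) (sub-cong (λ { here → refl ; (there x) → exts-wk τ (σ x) }) u))
  (trans (sub-sub (exts σ) (exts τ) v) (sub-cong (λ { here → refl ; (there x) → exts-wk τ (σ x) }) v))

sub-id : (t : Tm Γ A) → subst var t ≡ t
sub-id (var x) = refl
sub-id (lam t) = cong lam (trans (sub-cong (λ { here → refl ; (there x) → refl }) t) (sub-id t))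
sub-id (app t u) = cong₂ app (sub-id t) (sub-id u)
sub-id unit = refl
sub-id (pair t u) = cong₂ pair (sub-id t) (sub-id u)
sub-id (fst t) = cong fst (sub-id t)
sub-id (snd t) = cong snd (sub-id t)
sub-id (inl t) = cong inl (sub-id t)
sub-id (inr t) = cong inr (sub-id t)
sub-id (case t u v) = case-≡ (sub-id t)
  (trans (sub-cong (λ { here → refl ; (there x) → refl }) u) (sub-id u))
  (trans (sub-cong (λ { here → refl ; (there x) → refl }) v) (sub-id v))

ren-as-sub : (ρ : Ren Γ Δ) (t : Tm Γ A) → rename ρ t ≡ subst (λ x → var (ρ x)) t
ren-as-sub ρ t = trans (sym (sub-id (rename ρ t))) (ren-sub ρ var t)

-- βη-equality is preserved by substitution, both in the term and in the
-- substitution.  This is what makes open terms behave as morphisms.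

≡→≈ : {t u : Tm Γ A} → t ≡ u → t ≈ u
≡→≈ refl = ≈refl

infixr 2 _≈⟨_⟩_ _≡⟨_⟩_
infix 3 _∎

_≈⟨_⟩_ : (t : Tm Γ A) {u v : Tm Γ A} → t ≈ u → u ≈ v → t ≈ v
t ≈⟨ p ⟩ q = ≈trans p q

_≡⟨_⟩_ : (t : Tm Γ A) {u v : Tm Γ A} → t ≡ u → u ≈ v → t ≈ v
t ≡⟨ p ⟩ q = ≈trans (≡→≈ p) q

_∎ : (t : Tm Γ A) → t ≈ t
t ∎ = ≈refl

subst-[] : (σ : Sub Γ Δ) (t : Tm (A ∷ Γ) B) (u : Tm Γ A) →
           subst σ (t [ u ]) ≡ (subst (exts σ) t) [ subst σ u ]
subst-[] σ t u = trans (sub-sub (sub₀ u) σ t) (trans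
  (sub-cong (λ { here → refl ;
                 (there x) → sym (trans (ren-sub there (sub₀ (subst σ u)) (σ x)) (sub-id (σ x))) }) t)
  (sym (sub-sub (exts σ) (sub₀ (subst σ u)) t)))

subInl-comm : (σ : Sub Γ Δ) (u : Tm ((A ∨ B) ∷ Γ) C) →
              subst subInl (subst (exts σ) u) ≡ subst (exts σ) (subst subInl u)
subInl-comm σ u = trans (sub-sub (exts σ) subInl u) (trans
  (sub-cong (λ { here → refl ;
                 (there x) → trans (ren-sub there subInl (σ x)) (sym (ren-as-sub there (σ x))) }) u)
  (sym (sub-sub subInl (exts σ) u)))

subInr-comm : (σ : Sub Γ Δ) (u : Tm ((A ∨ B) ∷ Γ) C) →
              subst subInr (subst (exts σ) u) ≡ subst (exts σ) (subst subInr u)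
subInr-comm σ u = trans (sub-sub (exts σ) subInr u) (trans
  (sub-cong (λ { here → refl ;
                 (there x) → trans (ren-sub there subInr (σ x)) (sym (ren-as-sub there (σ x))) }) u)
  (sym (sub-sub subInr (exts σ) u)))

subst-≈ : (σ : Sub Γ Δ) {t t' : Tm Γ A} → t ≈ t' → subst σ t ≈ subst σ t'
subst-≈ σ ≈refl = ≈refl
subst-≈ σ (≈sym p) = ≈sym (subst-≈ σ p)
subst-≈ σ (≈trans p q) = ≈trans (subst-≈ σ p) (subst-≈ σ q)
subst-≈ σ (lam-cong p) = lam-cong (subst-≈ (exts σ) p)
subst-≈ σ (app-cong p q) = app-cong (subst-≈ σ p) (subst-≈ σ q)
subst-≈ σ (pair-cong p q) = pair-cong (subst-≈ σ p) (subst-≈ σ q)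
subst-≈ σ (fst-cong p) = fst-cong (subst-≈ σ p)
subst-≈ σ (snd-cong p) = snd-cong (subst-≈ σ p)
subst-≈ σ (inl-cong p) = inl-cong (subst-≈ σ p)
subst-≈ σ (inr-cong p) = inr-cong (subst-≈ σ p)
subst-≈ σ (case-cong p q r) = case-cong (subst-≈ σ p) (subst-≈ (exts σ) q) (subst-≈ (exts σ) r)
subst-≈ σ (β-⇒ {t = t} {u = u}) = ≈trans β-⇒ (≡→≈ (sym (subst-[] σ t u)))
subst-≈ σ β-∧₁ = β-∧₁
subst-≈ σ β-∧₂ = β-∧₂
subst-≈ σ (β-∨₁ {t = t} {u = u}) = ≈trans β-∨₁ (≡→≈ (sym (subst-[] σ u t)))
subst-≈ σ (β-∨₂ {t = t} {v = v}) = ≈trans β-∨₂ (≡→≈ (sym (subst-[] σ v t)))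
subst-≈ σ (η-⇒ {t = t}) = ≈trans η-⇒ (lam-cong (app-cong (≡→≈ (sym (exts-wk σ t))) ≈refl))
subst-≈ σ η-∧ = η-∧
subst-≈ σ η-⊤ = η-⊤
subst-≈ σ (η-∨ {t = t} {u = u}) =
  ≈trans (≡→≈ (subst-[] σ u t)) (≈trans (η-∨ {u = subst (exts σ) u})
    (≡→≈ (case-≡ refl (subInl-comm σ u) (subInr-comm σ u))))

wk-≈ : {t t' : Tm Γ A} → t ≈ t' → wk {B = B} t ≈ wk t'
wk-≈ {t = t} {t'} p = ≈trans (≡→≈ (ren-as-sub there t))
  (≈trans (subst-≈ _ p) (≡→≈ (sym (ren-as-sub there t'))))

subst-≈-pointwise : {σ τ : Sub Γ Δ} → (∀ {A} (x : Γ ∋ A) → σ x ≈ τ x) →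
                    (t : Tm Γ A) → subst σ t ≈ subst τ t
subst-≈-pointwise e (var x) = e x
subst-≈-pointwise e (lam t) = lam-cong (subst-≈-pointwise (λ { here → ≈refl ; (there x) → wk-≈ (e x) }) t)
subst-≈-pointwise e (app t u) = app-cong (subst-≈-pointwise e t) (subst-≈-pointwise e u)
subst-≈-pointwise e unit = ≈refl
subst-≈-pointwise e (pair t u) = pair-cong (subst-≈-pointwise e t) (subst-≈-pointwise e u)
subst-≈-pointwise e (fst t) = fst-cong (subst-≈-pointwise e t)
subst-≈-pointwise e (snd t) = snd-cong (subst-≈-pointwise e t)
subst-≈-pointwise e (inl t) = inl-cong (subst-≈-pointwise e t)
subst-≈-pointwise e (inr t) = inr-cong (subst-≈-pointwise e t)
subst-≈-pointwise e (case t u v) = case-cong (subst-≈-pointwise e t)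
  (subst-≈-pointwise (λ { here → ≈refl ; (there x) → wk-≈ (e x) }) u)
  (subst-≈-pointwise (λ { here → ≈refl ; (there x) → wk-≈ (e x) }) v)

-- Morphisms A → B are terms with one free variable of type A; composition
-- g ∙ t plugs t into g.  Working with open terms avoids β-redexes
-- app (lam g) t everywhere.

sub1 : Tm Γ A → Sub (A ∷ []) Γ
sub1 t here = t
sub1 t (there ())

infixr 9 _∙_
_∙_ : Tm (A ∷ []) B → Tm Γ A → Tm Γ B
f ∙ t = subst (sub1 t) f

v0 : Tm (A ∷ Γ) A
v0 = var here
v1 : Tm (B ∷ A ∷ Γ) A
v1 = var (there here)
v2 : Tm (C ∷ B ∷ A ∷ Γ) A
v2 = var (there (there here))

∙-subst : (σ : Sub Γ Δ) (f : Tm (A ∷ []) B) (t : Tm Γ A) → subst σ (f ∙ t) ≡ f ∙ subst σ t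
∙-subst σ f t = trans (sub-sub (sub1 t) σ f) (sub-cong (λ { here → refl ; (there ()) }) f)

∙-ren : (ρ : Ren Γ Δ) (f : Tm (A ∷ []) B) (t : Tm Γ A) → rename ρ (f ∙ t) ≡ f ∙ rename ρ t
∙-ren ρ f t = trans (ren-as-sub ρ (f ∙ t)) (trans (∙-subst _ f t) (cong (f ∙_) (sym (ren-as-sub ρ t))))

∙-assoc : (g : Tm (B ∷ []) C) (f : Tm (A ∷ []) B) (t : Tm Γ A) → (g ∙ f) ∙ t ≡ g ∙ (f ∙ t)
∙-assoc g f t = ∙-subst (sub1 t) g f

∙-idʳ : (f : Tm (A ∷ []) B) → f ∙ v0 ≡ f
∙-idʳ f = trans (sub-cong (λ { here → refl ; (there ()) }) f) (sub-id f)

∙-congˡ : {g g' : Tm (A ∷ []) B} {t : Tm Γ A} → g ≈ g' → g ∙ t ≈ g' ∙ t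
∙-congˡ p = subst-≈ _ p

∙-congʳ : (g : Tm (A ∷ []) B) {t t' : Tm Γ A} → t ≈ t' → g ∙ t ≈ g ∙ t'
∙-congʳ g p = subst-≈-pointwise (λ { here → p ; (there ()) }) g

cancel : (g : Tm (B ∷ []) A) (f : Tm (A ∷ []) B) → g ∙ f ≈ v0 → (t : Tm Γ A) → g ∙ (f ∙ t) ≈ t
cancel g f p t = ≈trans (≡→≈ (sym (∙-assoc g f t))) (∙-congˡ p)

record Iso (A B : Form) : Set where
  field
    fw : Tm (A ∷ []) B
    bw : Tm (B ∷ []) A
    bw∙fw : bw ∙ fw ≈ v0
    fw∙bw : fw ∙ bw ≈ v0
open Iso

-- Abstracting the variable turns an inverse pair of open terms into the
-- closed proofs φ, ψ of _≅_.
wk-lam-app : (g : Tm (A ∷ []) B) (f : Tm (C ∷ []) A) → (rename (ext there) g) [ f ] ≡ g ∙ f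
wk-lam-app g f = trans (ren-sub (ext there) (sub₀ f) g) (sub-cong (λ { here → refl ; (there ()) }) g)

closed-inverse : (g : Tm (B ∷ []) A) (f : Tm (A ∷ []) B) → g ∙ f ≈ v0 →
                 lam (app (wk (lam g)) (app (wk (lam f)) v0)) ≈ lam v0
closed-inverse g f p = lam-cong
  (≈trans (app-cong ≈refl (≈trans β-⇒ (≡→≈ (trans (wk-lam-app f v0) (∙-idʳ f)))))
  (≈trans β-⇒ (≈trans (≡→≈ (wk-lam-app g f)) p)))

toIso : Iso A B → A ≅ B
toIso i = record { φ = lam (fw i) ; ψ = lam (bw i)
                 ; ψφ = closed-inverse (bw i) (fw i) (bw∙fw i)
                 ; φψ = closed-inverse (fw i) (bw i) (fw∙bw i) }

-- Equations between concrete terms are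
-- checked by reducing both sides a fixed number of times and comparing
-- them syntactically (byRed); this discharges the routine β-steps below.

rapp : Tm Γ (A ⇒ B) → Tm Γ A → Tm Γ B
rapp (lam t) u = t [ u ]
rapp t u = app t u

rfst : Tm Γ (A ∧ B) → Tm Γ A
rfst (pair t u) = t
rfst t = fst t

rsnd : Tm Γ (A ∧ B) → Tm Γ B
rsnd (pair t u) = u
rsnd t = snd t

rcase : Tm Γ (A ∨ B) → Tm (A ∷ Γ) C → Tm (B ∷ Γ) C → Tm Γ C
rcase (inl t) u v = u [ t ]
rcase (inr t) u v = v [ t ]
rcase t u v = case t u v

red1 : Tm Γ A → Tm Γ A
red1 (var x) = var x
red1 (lam t) = lam (red1 t)
red1 (app t u) = rapp (red1 t) (red1 u)
red1 unit = unit
red1 (pair t u) = pair (red1 t) (red1 u)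
red1 (fst t) = rfst (red1 t)
red1 (snd t) = rsnd (red1 t)
red1 (inl t) = inl (red1 t)
red1 (inr t) = inr (red1 t)
red1 (case t u v) = rcase (red1 t) (red1 u) (red1 v)

rapp-≈ : (t : Tm Γ (A ⇒ B)) (u : Tm Γ A) → app t u ≈ rapp t u
rapp-≈ (var x) u = ≈refl
rapp-≈ (lam t) u = β-⇒
rapp-≈ (app t t') u = ≈refl
rapp-≈ (fst t) u = ≈refl
rapp-≈ (snd t) u = ≈refl
rapp-≈ (case t t' t'') u = ≈refl

rfst-≈ : (t : Tm Γ (A ∧ B)) → fst t ≈ rfst t
rfst-≈ (var x) = ≈refl
rfst-≈ (app t t') = ≈refl
rfst-≈ (pair t t') = β-∧₁
rfst-≈ (fst t) = ≈refl
rfst-≈ (snd t) = ≈refl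
rfst-≈ (case t t' t'') = ≈refl

rsnd-≈ : (t : Tm Γ (A ∧ B)) → snd t ≈ rsnd t
rsnd-≈ (var x) = ≈refl
rsnd-≈ (app t t') = ≈refl
rsnd-≈ (pair t t') = β-∧₂
rsnd-≈ (fst t) = ≈refl
rsnd-≈ (snd t) = ≈refl
rsnd-≈ (case t t' t'') = ≈refl

rcase-≈ : (t : Tm Γ (A ∨ B)) (u : Tm (A ∷ Γ) C) (v : Tm (B ∷ Γ) C) → case t u v ≈ rcase t u v
rcase-≈ (var x) u v = ≈refl
rcase-≈ (app t t') u v = ≈refl
rcase-≈ (fst t) u v = ≈refl
rcase-≈ (snd t) u v = ≈refl
rcase-≈ (inl t) u v = β-∨₁
rcase-≈ (inr t) u v = β-∨₂
rcase-≈ (case t t' t'') u v = ≈refl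

red1-≈ : (t : Tm Γ A) → t ≈ red1 t
red1-≈ (var x) = ≈refl
red1-≈ (lam t) = lam-cong (red1-≈ t)
red1-≈ (app t u) = ≈trans (app-cong (red1-≈ t) (red1-≈ u)) (rapp-≈ _ _)
red1-≈ unit = ≈refl
red1-≈ (pair t u) = pair-cong (red1-≈ t) (red1-≈ u)
red1-≈ (fst t) = ≈trans (fst-cong (red1-≈ t)) (rfst-≈ _)
red1-≈ (snd t) = ≈trans (snd-cong (red1-≈ t)) (rsnd-≈ _)
red1-≈ (inl t) = inl-cong (red1-≈ t)
red1-≈ (inr t) = inr-cong (red1-≈ t)
red1-≈ (case t u v) = ≈trans (case-cong (red1-≈ t) (red1-≈ u) (red1-≈ v)) (rcase-≈ _ _ _)

red : ℕ → Tm Γ A → Tm Γ A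
red zero t = t
red (suc n) t = red n (red1 t)

red-≈ : (n : ℕ) (t : Tm Γ A) → t ≈ red n t
red-≈ zero t = ≈refl
red-≈ (suc n) t = ≈trans (red1-≈ t) (red-≈ n (red1 t))

byRed : (n : ℕ) {t t' : Tm Γ A} → red n t ≡ red n t' → t ≈ t'
byRed n {t} {t'} e = ≈trans (red-≈ n t) (≈trans (≡→≈ e) (≈sym (red-≈ n t')))

sum-ext-at : (t : Tm Γ (A ∨ B)) {u u' : Tm ((A ∨ B) ∷ Γ) C} →
             subst subInl u ≈ subst subInl u' → subst subInr u ≈ subst subInr u' → u [ t ] ≈ u' [ t ]
sum-ext-at t {u} {u'} p q = ≈trans (η-∨ {u = u}) (≈trans (case-cong ≈refl p q) (≈sym (η-∨ {u = u'})))

-- Replace the head variable by inl / inr of a fresh variable, keeping it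
-- in the context (so the statement of sum-ext needs no strengthening).
σl : Sub ((A ∨ B) ∷ Γ) (A ∷ (A ∨ B) ∷ Γ)
σl here = inl v0
σl (there x) = var (there (there x))

σr : Sub ((A ∨ B) ∷ Γ) (B ∷ (A ∨ B) ∷ Γ)
σr here = inr v0
σr (there x) = var (there (there x))

sum-ext : {s s' : Tm ((A ∨ B) ∷ Γ) C} → subst σl s ≈ subst σl s' → subst σr s ≈ subst σr s' → s ≈ s'
sum-ext {s = s} {s'} p q =
  ≈trans (≡→≈ (sym (lift-v0 s))) (≈trans
    (sum-ext-at v0 {rename (ext there) s} {rename (ext there) s'}
       (≈trans (≡→≈ (lift-inl s)) (≈trans p (≡→≈ (sym (lift-inl s')))))
       (≈trans (≡→≈ (lift-inr s)) (≈trans q (≡→≈ (sym (lift-inr s'))))))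
    (≡→≈ (lift-v0 s')))
  where
  lift-v0 : (s : Tm ((A ∨ B) ∷ Γ) C) → (rename (ext there) s) [ v0 ] ≡ s
  lift-v0 s = trans (ren-sub (ext there) _ s) (trans (sub-cong (λ { here → refl ; (there x) → refl }) s) (sub-id s))
  lift-inl : (s : Tm ((A ∨ B) ∷ Γ) C) → subst subInl (rename (ext there) s) ≡ subst σl s
  lift-inl s = trans (ren-sub (ext there) _ s) (sub-cong (λ { here → refl ; (there x) → refl }) s)
  lift-inr : (s : Tm ((A ∨ B) ∷ Γ) C) → subst subInr (rename (ext there) s) ≡ subst σr s
  lift-inr s = trans (ren-sub (ext there) _ s) (sub-cong (λ { here → refl ; (there x) → refl }) s)

idᴵ : Iso A A
idᴵ = record { fw = v0 ; bw = v0 ; bw∙fw = ≈refl ; fw∙bw = ≈refl }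

infixr 4 _▹_
_▹_ : Iso A B → Iso B C → Iso A C
i ▹ j = record { fw = fw j ∙ fw i ; bw = bw i ∙ bw j
  ; bw∙fw = law (bw i) (bw j) (fw j) (fw i) (bw∙fw j) (bw∙fw i)
  ; fw∙bw = law (fw j) (fw i) (bw i) (bw j) (fw∙bw i) (fw∙bw j) }
  where
  law : ∀ {A B C} (b₁ : Tm (B ∷ []) A) (b₂ : Tm (C ∷ []) B) (f₂ : Tm (B ∷ []) C) (f₁ : Tm (A ∷ []) B) →
        b₂ ∙ f₂ ≈ v0 → b₁ ∙ f₁ ≈ v0 → (b₁ ∙ b₂) ∙ (f₂ ∙ f₁) ≈ v0
  law b₁ b₂ f₂ f₁ p q =
    (b₁ ∙ b₂) ∙ (f₂ ∙ f₁) ≡⟨ ∙-assoc b₁ b₂ (f₂ ∙ f₁) ⟩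
    b₁ ∙ (b₂ ∙ (f₂ ∙ f₁)) ≈⟨ ∙-congʳ b₁ (cancel b₂ f₂ p f₁) ⟩
    b₁ ∙ f₁               ≈⟨ q ⟩
    v0                    ∎

≡→Iso : A ≡ B → Iso A B
≡→Iso refl = idᴵ

-- The basic isomorphisms of exponential polynomials.  The inverse laws are
-- β-reduction followed by the η-rules.

topImp : Iso A (⊤ ⇒ A)
topImp = record { fw = lam v1 ; bw = app v0 unit ; bw∙fw = byRed 1 refl
  ; fw∙bw = ≈trans (lam-cong (app-cong ≈refl (≈sym η-⊤))) (≈sym η-⇒) }

impTop : Iso (A ⇒ ⊤) ⊤
impTop = record { fw = unit ; bw = lam unit
  ; bw∙fw = ≈trans (lam-cong (≈sym η-⊤)) (≈sym η-⇒) ; fw∙bw = ≈sym η-⊤ }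

topConj : Iso (⊤ ∧ A) A
topConj = record { fw = snd v0 ; bw = pair unit v0
  ; bw∙fw = ≈trans (pair-cong (≈sym η-⊤) ≈refl) (≈sym η-∧) ; fw∙bw = β-∧₂ }

conjTop : Iso (A ∧ ⊤) A
conjTop = record { fw = fst v0 ; bw = pair v0 unit
  ; bw∙fw = ≈trans (pair-cong ≈refl (≈sym η-⊤)) (≈sym η-∧) ; fw∙bw = β-∧₁ }

conjAssoc : Iso ((A ∧ B) ∧ C) (A ∧ (B ∧ C))
conjAssoc = record
  { fw = pair (fst (fst v0)) (pair (snd (fst v0)) (snd v0))
  ; bw = pair (pair (fst v0) (fst (snd v0))) (snd (snd v0))
  ; bw∙fw = ≈trans (byRed 2 refl) (≈trans (pair-cong (≈sym η-∧) ≈refl) (≈sym η-∧))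
  ; fw∙bw = ≈trans (byRed 2 refl) (≈trans (pair-cong ≈refl (≈sym η-∧)) (≈sym η-∧)) }

disjAssoc : Iso ((A ∨ B) ∨ C) (A ∨ (B ∨ C))
disjAssoc = record
  { fw = case v0 (case v0 (inl v0) (inr (inl v0))) (inr (inr v0))
  ; bw = case v0 (inl (inl v0)) (case v0 (inl (inr v0)) (inr v0))
  ; bw∙fw = sum-ext (sum-ext (byRed 3 refl) (byRed 3 refl)) (byRed 3 refl)
  ; fw∙bw = sum-ext (byRed 3 refl) (sum-ext (byRed 3 refl) (byRed 3 refl)) }

distR : Iso ((A ∨ B) ∧ C) ((A ∧ C) ∨ (B ∧ C))
distR = record
  { fw = case (fst v0) (inl (pair v0 (snd v1))) (inr (pair v0 (snd v1)))
  ; bw = case v0 (pair (inl (fst v0)) (snd v0)) (pair (inr (fst v0)) (snd v0))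
  ; bw∙fw = ≈trans (sum-ext-at (fst v0)
              {case (case v0 (inl (pair v0 (snd v2))) (inr (pair v0 (snd v2))))
                    (pair (inl (fst v0)) (snd v0)) (pair (inr (fst v0)) (snd v0))}
              {pair v0 (snd v1)} (byRed 3 refl) (byRed 3 refl)) (≈sym η-∧)
  ; fw∙bw = sum-ext (≈trans (byRed 3 refl) (inl-cong (≈sym η-∧)))
                    (≈trans (byRed 3 refl) (inr-cong (≈sym η-∧))) }

distL : Iso (A ∧ (B ∨ C)) ((A ∧ B) ∨ (A ∧ C))
distL = record
  { fw = case (snd v0) (inl (pair (fst v1) v0)) (inr (pair (fst v1) v0))
  ; bw = case v0 (pair (fst v0) (inl (snd v0))) (pair (fst v0) (inr (snd v0)))
  ; bw∙fw = ≈trans (sum-ext-at (snd v0)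
              {case (case v0 (inl (pair (fst v2) v0)) (inr (pair (fst v2) v0)))
                    (pair (fst v0) (inl (snd v0))) (pair (fst v0) (inr (snd v0)))}
              {pair (fst v1) v0} (byRed 3 refl) (byRed 3 refl)) (≈sym η-∧)
  ; fw∙bw = sum-ext (≈trans (byRed 3 refl) (inl-cong (≈sym η-∧)))
                    (≈trans (byRed 3 refl) (inr-cong (≈sym η-∧))) }

lam-η : (t : Tm Γ (A ⇒ B)) → lam (app (wk t) v0) ≈ t
lam-η t = ≈sym η-⇒

disjImp : Iso ((A ∨ B) ⇒ C) ((A ⇒ C) ∧ (B ⇒ C))
disjImp = record
  { fw = pair (lam (app v1 (inl v0))) (lam (app v1 (inr v0)))
  ; bw = lam (case v0 (app (fst v2) v0) (app (snd v2) v0))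
  ; bw∙fw = ≈trans (byRed 3 refl) (≈trans (lam-cong
              (sum-ext {s = case v0 (app v2 (inl v0)) (app v2 (inr v0))} {s' = app v1 v0}
                 (byRed 3 refl) (byRed 3 refl))) (lam-η v0))
  ; fw∙bw = ≈trans (byRed 3 refl) (≈trans (pair-cong (lam-η (fst v0)) (lam-η (snd v0))) (≈sym η-∧)) }

impConj : Iso (A ⇒ (B ∧ C)) ((A ⇒ B) ∧ (A ⇒ C))
impConj = record
  { fw = pair (lam (fst (app v1 v0))) (lam (snd (app v1 v0)))
  ; bw = lam (pair (app (fst v1) v0) (app (snd v1) v0))
  ; bw∙fw = ≈trans (byRed 3 refl) (≈trans (lam-cong (≈sym η-∧)) (lam-η v0))
  ; fw∙bw = ≈trans (byRed 3 refl) (≈trans (pair-cong (lam-η (fst v0)) (lam-η (snd v0))) (≈sym η-∧)) }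

curry : Iso (A ⇒ (B ⇒ C)) ((B ∧ A) ⇒ C)
curry = record
  { fw = lam (app (app v1 (snd v0)) (fst v0))
  ; bw = lam (lam (app v2 (pair v0 v1)))
  ; bw∙fw = ≈trans (byRed 3 refl) (≈trans (lam-cong (lam-η (app v1 v0))) (lam-η v0))
  ; fw∙bw = ≈trans (byRed 3 refl) (≈trans (lam-cong (app-cong ≈refl (≈sym η-∧))) (lam-η v0)) }

-- Each connective acts on
-- morphisms (∧-map, ∨-map, ⇒-map, the last contravariantly in the
-- antecedent), and this action sends inverse pairs to inverse pairs.

∧-map : Tm (A ∷ []) C → Tm (B ∷ []) D → Tm ((A ∧ B) ∷ []) (C ∧ D)
∧-map f g = pair (f ∙ fst v0) (g ∙ snd v0)

∧-map-∙ : (f : Tm (A ∷ []) C) (g : Tm (B ∷ []) D) (t : Tm Γ (A ∧ B)) →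
          ∧-map f g ∙ t ≡ pair (f ∙ fst t) (g ∙ snd t)
∧-map-∙ f g t = cong₂ pair (∙-subst (sub1 t) f (fst v0)) (∙-subst (sub1 t) g (snd v0))

∧-map-inverse : (f₁ : Tm (A ∷ []) C) (g₁ : Tm (C ∷ []) A) (f₂ : Tm (B ∷ []) D) (g₂ : Tm (D ∷ []) B) →
                g₁ ∙ f₁ ≈ v0 → g₂ ∙ f₂ ≈ v0 → ∧-map g₁ g₂ ∙ ∧-map f₁ f₂ ≈ v0
∧-map-inverse f₁ g₁ f₂ g₂ p q =
  ∧-map g₁ g₂ ∙ ∧-map f₁ f₂
    ≡⟨ ∧-map-∙ g₁ g₂ (∧-map f₁ f₂) ⟩
  pair (g₁ ∙ fst (∧-map f₁ f₂)) (g₂ ∙ snd (∧-map f₁ f₂))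
    ≈⟨ pair-cong (∙-congʳ g₁ β-∧₁) (∙-congʳ g₂ β-∧₂) ⟩
  pair (g₁ ∙ (f₁ ∙ fst v0)) (g₂ ∙ (f₂ ∙ snd v0))
    ≈⟨ pair-cong (cancel g₁ f₁ p _) (cancel g₂ f₂ q _) ⟩
  pair (fst v0) (snd v0)
    ≈⟨ ≈sym η-∧ ⟩
  v0 ∎

∨-map : Tm (A ∷ []) C → Tm (B ∷ []) D → Tm ((A ∨ B) ∷ []) (C ∨ D)
∨-map f g = case v0 (inl (f ∙ v0)) (inr (g ∙ v0))

∨-map-inl : (f : Tm (A ∷ []) C) (g : Tm (B ∷ []) D) (t : Tm Γ A) → ∨-map f g ∙ inl t ≈ inl (f ∙ t)
∨-map-inl f g t =
  ≈trans (case-cong ≈refl (≡→≈ (cong inl (∙-subst _ f v0))) ≈refl)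
         (≈trans β-∨₁ (≡→≈ (cong inl (∙-subst _ f v0))))

∨-map-inr : (f : Tm (A ∷ []) C) (g : Tm (B ∷ []) D) (t : Tm Γ B) → ∨-map f g ∙ inr t ≈ inr (g ∙ t)
∨-map-inr f g t =
  ≈trans (case-cong ≈refl ≈refl (≡→≈ (cong inr (∙-subst _ g v0))))
         (≈trans β-∨₂ (≡→≈ (cong inr (∙-subst _ g v0))))

∨-map-inverse : (f₁ : Tm (A ∷ []) C) (g₁ : Tm (C ∷ []) A) (f₂ : Tm (B ∷ []) D) (g₂ : Tm (D ∷ []) B) →
                g₁ ∙ f₁ ≈ v0 → g₂ ∙ f₂ ≈ v0 → ∨-map g₁ g₂ ∙ ∨-map f₁ f₂ ≈ v0
∨-map-inverse f₁ g₁ f₂ g₂ p q = sum-ext on-inl on-inr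
  where
  G = ∨-map g₁ g₂
  F = ∨-map f₁ f₂
  on-inl : subst σl (G ∙ F) ≈ inl v0
  on-inl =
    subst σl (G ∙ F)     ≡⟨ ∙-subst σl G F ⟩
    G ∙ subst σl F       ≡⟨ cong (G ∙_) (sub-cong (λ { here → refl ; (there ()) }) F) ⟩
    G ∙ (F ∙ inl v0)     ≈⟨ ∙-congʳ G (∨-map-inl f₁ f₂ v0) ⟩
    G ∙ inl (f₁ ∙ v0)    ≈⟨ ∨-map-inl g₁ g₂ _ ⟩
    inl (g₁ ∙ (f₁ ∙ v0)) ≈⟨ inl-cong (cancel g₁ f₁ p v0) ⟩
    inl v0               ∎
  on-inr : subst σr (G ∙ F) ≈ inr v0
  on-inr =
    subst σr (G ∙ F)     ≡⟨ ∙-subst σr G F ⟩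
    G ∙ subst σr F       ≡⟨ cong (G ∙_) (sub-cong (λ { here → refl ; (there ()) }) F) ⟩
    G ∙ (F ∙ inr v0)     ≈⟨ ∙-congʳ G (∨-map-inr f₁ f₂ v0) ⟩
    G ∙ inr (f₂ ∙ v0)    ≈⟨ ∨-map-inr g₁ g₂ _ ⟩
    inr (g₂ ∙ (f₂ ∙ v0)) ≈⟨ inr-cong (cancel g₂ f₂ q v0) ⟩
    inr v0               ∎

⇒-map : Tm (C ∷ []) A → Tm (B ∷ []) D → Tm ((A ⇒ B) ∷ []) (C ⇒ D)
⇒-map f g = lam (g ∙ app v1 (f ∙ v0))

⇒-map-inverse : (f₁ : Tm (A ∷ []) C) (g₁ : Tm (C ∷ []) A) (f₂ : Tm (B ∷ []) D) (g₂ : Tm (D ∷ []) B) →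
                g₁ ∙ f₁ ≈ v0 → g₂ ∙ f₂ ≈ v0 → ⇒-map f₁ g₂ ∙ ⇒-map g₁ f₂ ≈ v0
⇒-map-inverse f₁ g₁ f₂ g₂ p q = ≈trans (lam-cong body) (lam-η v0)
  where
  F = ⇒-map g₁ f₂
  τ = exts (sub1 F)
  body : subst τ (g₂ ∙ app v1 (f₁ ∙ v0)) ≈ app v1 v0
  body =
    subst τ (g₂ ∙ app v1 (f₁ ∙ v0))
      ≡⟨ trans (∙-subst τ g₂ _) (cong (λ z → g₂ ∙ app (wk F) z) (∙-subst τ f₁ v0)) ⟩
    g₂ ∙ app (wk F) (f₁ ∙ v0)
      ≡⟨ cong (λ z → g₂ ∙ app (lam z) (f₁ ∙ v0))
           (trans (∙-ren (ext there) f₂ _) (cong (λ z → f₂ ∙ app v2 z) (∙-ren (ext there) g₁ v0))) ⟩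
    g₂ ∙ app (lam (f₂ ∙ app v2 (g₁ ∙ v0))) (f₁ ∙ v0)
      ≈⟨ ∙-congʳ g₂ β-⇒ ⟩
    g₂ ∙ ((f₂ ∙ app v2 (g₁ ∙ v0)) [ f₁ ∙ v0 ])
      ≡⟨ cong (g₂ ∙_) (trans (∙-subst (sub₀ _) f₂ _) (cong (λ z → f₂ ∙ app v1 z) (∙-subst _ g₁ v0))) ⟩
    g₂ ∙ (f₂ ∙ app v1 (g₁ ∙ (f₁ ∙ v0)))
      ≈⟨ ∙-congʳ g₂ (∙-congʳ f₂ (app-cong ≈refl (cancel g₁ f₁ p v0))) ⟩
    g₂ ∙ (f₂ ∙ app v1 v0)
      ≈⟨ cancel g₂ f₂ q _ ⟩
    app v1 v0 ∎

∧-congᴵ : Iso A C → Iso B D → Iso (A ∧ B) (C ∧ D)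
∧-congᴵ i j = record
  { fw = ∧-map (fw i) (fw j) ; bw = ∧-map (bw i) (bw j)
  ; bw∙fw = ∧-map-inverse (fw i) (bw i) (fw j) (bw j) (bw∙fw i) (bw∙fw j)
  ; fw∙bw = ∧-map-inverse (bw i) (fw i) (bw j) (fw j) (fw∙bw i) (fw∙bw j) }

∨-congᴵ : Iso A C → Iso B D → Iso (A ∨ B) (C ∨ D)
∨-congᴵ i j = record
  { fw = ∨-map (fw i) (fw j) ; bw = ∨-map (bw i) (bw j)
  ; bw∙fw = ∨-map-inverse (fw i) (bw i) (fw j) (bw j) (bw∙fw i) (bw∙fw j)
  ; fw∙bw = ∨-map-inverse (bw i) (fw i) (bw j) (fw j) (fw∙bw i) (fw∙bw j) }

⇒-congᴵ : Iso A C → Iso B D → Iso (A ⇒ B) (C ⇒ D)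
⇒-congᴵ i j = record
  { fw = ⇒-map (bw i) (fw j) ; bw = ⇒-map (fw i) (bw j)
  ; bw∙fw = ⇒-map-inverse (fw i) (bw i) (fw j) (bw j) (bw∙fw i) (bw∙fw j)
  ; fw∙bw = ⇒-map-inverse (bw i) (fw i) (bw j) (fw j) (fw∙bw i) (fw∙bw j) }

factor : Form × Form → Form
factor p = proj₁ p ⇒ proj₂ p

IsFactor : Form × Form → Set
IsFactor p = IsC (proj₁ p) × IsB (proj₂ p)

⊤-C : IsC ⊤
⊤-C = conj [] []

factor-C : IsC A → IsB B → IsC (A ⇒ B)
factor-C {A} {B} ia ib = conj ((A , B) ∷ []) ((ia , ib) ∷ [])

Sum : Form → List Form → Form
Sum c [] = c
Sum c (d ∷ ds) = c ∨ Sum d ds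

Sum≡⋁₂ : (c d : Form) (ds : List Form) → Sum c (d ∷ ds) ≡ ⋁₂ c d ds
Sum≡⋁₂ c d [] = refl
Sum≡⋁₂ c d (d' ∷ ds) = cong (c ∨_) (Sum≡⋁₂ d d' ds)

Sum-D : {c d : Form} {ds : List Form} → IsC c → IsC d → All IsC ds → IsD (Sum c (d ∷ ds))
Sum-D {c} {d} {ds} ic id ids with Sum c (d ∷ ds) | Sum≡⋁₂ c d ds
... | _ | refl = disj ds ic id ids

record IsoToC (F : Form) : Set where
  constructor isoToC
  field
    target   : Form
    target-C : IsC target
    iso      : Iso F target

record IsoToSum (F : Form) : Set where
  constructor isoToSum
  field
    first   : Form
    rest    : List Form
    first-C : IsC first
    rest-C  : All IsC rest
    iso     : Iso F (Sum first rest)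

Sum-++ : (c : Form) (cs : List Form) (d : Form) (ds : List Form) →
         Iso (Sum c cs ∨ Sum d ds) (Sum c (cs ++ d ∷ ds))
Sum-++ c [] d ds = idᴵ
Sum-++ c (c' ∷ cs) d ds = disjAssoc ▹ ∨-congᴵ idᴵ (Sum-++ c' cs d ds)

⋀-++ : (xs ys : List Form) → Iso (⋀ xs ∧ ⋀ ys) (⋀ (xs ++ ys))
⋀-++ [] ys = topConj
⋀-++ (x ∷ []) [] = conjTop
⋀-++ (x ∷ []) (y ∷ ys) = idᴵ
⋀-++ (x ∷ y ∷ xs) ys = conjAssoc ▹ ∧-congᴵ idᴵ (⋀-++ (y ∷ xs) ys)

-- 𝒞 is closed under ∧ up to isomorphism: concatenate the factors.
∧-C : IsC A → IsC B → IsoToC (A ∧ B)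
∧-C (conj ps pa) (conj qs qa) =
  isoToC (⋀ (map factor (ps ++ qs))) (conj (ps ++ qs) (++⁺ pa qa))
         (⋀-++ (map factor ps) (map factor qs) ▹ ≡→Iso (cong ⋀ (sym (map-++ factor ps qs))))

C-∧-Sum : IsC A → (d : Form) (ds : List Form) → IsC d → All IsC ds → IsoToSum (A ∧ Sum d ds)
C-∧-Sum ia d [] id [] with ∧-C ia id
... | isoToC e ie i = isoToSum e [] ie [] i
C-∧-Sum ia d (d' ∷ ds) id (id' ∷ ids) with ∧-C ia id | C-∧-Sum ia d' ds id' ids
... | isoToC e ie i | isoToSum e' es ie' ies i' =
  isoToSum e (e' ∷ es) ie (ie' ∷ ies) (distL ▹ ∨-congᴵ i i')

Sum-∧-Sum : (c : Form) (cs : List Form) → IsC c → All IsC cs →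
            (d : Form) (ds : List Form) → IsC d → All IsC ds → IsoToSum (Sum c cs ∧ Sum d ds)
Sum-∧-Sum c [] ic [] d ds id ids = C-∧-Sum ic d ds id ids
Sum-∧-Sum c (c' ∷ cs) ic (ic' ∷ ics) d ds id ids
  with C-∧-Sum ic d ds id ids | Sum-∧-Sum c' cs ic' ics d ds id ids
... | isoToSum e es ie ies i | isoToSum e' es' ie' ies' i' =
  isoToSum e (es ++ e' ∷ es') ie (++⁺ ies (ie' ∷ ies')) (distR ▹ ∨-congᴵ i i' ▹ Sum-++ e es e' es')

-- 𝒞 is closed under exponentiation by a 𝒞-formula: distribute c → _ over
-- the factors and curry each factor, (b^c')^c ≅ b^(c'c).
C-⇒-C : IsC A → (qs : List (Form × Form)) → All IsFactor qs → IsoToC (A ⇒ ⋀ (map factor qs))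
C-⇒-C ia [] [] = isoToC ⊤ ⊤-C impTop
C-⇒-C ia ((c' , b) ∷ []) ((ic' , ib) ∷ []) with ∧-C ic' ia
... | isoToC e ie i = isoToC (e ⇒ b) (factor-C ie ib) (curry ▹ ⇒-congᴵ i idᴵ)
C-⇒-C ia (q ∷ q' ∷ qs) (iq ∷ iq' ∷ iqs) with C-⇒-C ia (q ∷ []) (iq ∷ []) | C-⇒-C ia (q' ∷ qs) (iq' ∷ iqs)
... | isoToC e ie i | isoToC e' ie' i' with ∧-C ie ie'
... | isoToC e'' ie'' i'' = isoToC e'' ie'' (impConj ▹ ∧-congᴵ i i' ▹ i'')

-- A sum raised to a 𝒞-formula is in 𝒞: a one-summand sum by C-⇒-C, a
-- longer one is itself a 𝒟-formula, so c → d is a single factor.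
C-⇒-Sum : IsC A → (d : Form) (ds : List Form) → IsC d → All IsC ds → IsoToC (A ⇒ Sum d ds)
C-⇒-Sum ia d [] (conj qs iqs) [] = C-⇒-C ia qs iqs
C-⇒-Sum ia d (d' ∷ ds) id (id' ∷ ids) = isoToC _ (factor-C ia (dis (Sum-D id id' ids))) idᴵ

Sum-⇒-Sum : (c : Form) (cs : List Form) → IsC c → All IsC cs →
            (d : Form) (ds : List Form) → IsC d → All IsC ds → IsoToC (Sum c cs ⇒ Sum d ds)
Sum-⇒-Sum c [] ic [] d ds id ids = C-⇒-Sum ic d ds id ids
Sum-⇒-Sum c (c' ∷ cs) ic (ic' ∷ ics) d ds id ids
  with C-⇒-Sum ic d ds id ids | Sum-⇒-Sum c' cs ic' ics d ds id ids
... | isoToC e ie i | isoToC e' ie' i' with ∧-C ie ie'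
... | isoToC e'' ie'' i'' = isoToC e'' ie'' (disjImp ▹ ∧-congᴵ i i' ▹ i'')

normalise : {F : Form} → TopFree F → IsoToSum F
normalise (prime n) = isoToSum (⊤ ⇒ prime n) [] (factor-C ⊤-C (prime n)) [] topImp
normalise (f ∧ g) with normalise f | normalise g
... | isoToSum c cs ic ics i | isoToSum d ds id ids j with Sum-∧-Sum c cs ic ics d ds id ids
... | isoToSum e es ie ies k = isoToSum e es ie ies (∧-congᴵ i j ▹ k)
normalise (f ∨ g) with normalise f | normalise g
... | isoToSum c cs ic ics i | isoToSum d ds id ids j =
  isoToSum c (cs ++ d ∷ ds) ic (++⁺ ics (id ∷ ids)) (∨-congᴵ i j ▹ Sum-++ c cs d ds)
normalise (f ⇒ g) with normalise f | normalise g
... | isoToSum c cs ic ics i | isoToSum d ds id ids j with Sum-⇒-Sum c cs ic ics d ds id ids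
... | isoToC e ie k = isoToSum e [] ie [] (⇒-congᴵ i j ▹ k)

theorem1 : (F : Form) → TopFree F → Σ Form (λ e → (IsD e ⊎ IsC e) × (F ≅ e))
theorem1 F tf with normalise tf
... | isoToSum c [] ic [] i = c , inj₂ ic , toIso i
... | isoToSum c (d ∷ ds) ic (id ∷ ids) i = Sum c (d ∷ ds) , inj₁ (Sum-D ic id ids) , toIso i
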